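{- Let $G$ be a connected trivially perfect graph having a true twin partition $\mathcal{W}=\{W_1,\dots,W_k\}$ such that $|W_i|\ge 6$ for each $i=1,\dots,k$. Then the distance matrix $D(G)$ is invertible, i.e., its nullity is $0$.
   Context: All graphs are finite and simple. A graph is trivially perfect if it contains no induced subgraph isomorphic to $P_4$ (path on 4 vertices) or $C_4$ (cycle on 4 vertices). Two vertices $u,v$ are true twins if $N[u]=N[v]$, where $N[v]$ is the closed neighborhood of $v$. A true twin partition of $G$ is a partition of $V(G)$ into sets each consisting of pairwise true twins. The distance matrix $D(G)$ of a connected graph has $(i,j)$-entry the shortest-path distance between the $i$-th and $j$-th vertices. -}

module Defs where

open import Data.Nat using (ℕ; zero; suc; _≤_)
open import Data.Fin using (Fin; zero; suc)
open import Data.Fin.Properties using (_≟_)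
open import Data.Bool using (Bool; true; false; _∨_)
open import Data.List using (length; filter)
open import Data.List.Base using (allFin)
open import Data.Integer using (+_)
open import Data.Rational using (ℚ; 0ℚ; _+_; _*_; _/_)
open import Data.Product using (_×_; Σ; ∃)
open import Relation.Binary.PropositionalEquality using (_≡_; _≢_)
open import Relation.Nullary using (¬_)
open import Relation.Nullary.Decidable using (⌊_⌋)

record Graph (n : ℕ) : Set where
  field
    adj   : Fin n → Fin n → Bool
    sym   : ∀ u v → adj u v ≡ adj v u
    irrefl : ∀ v → adj v v ≡ false
open Graph public

module _ {n : ℕ} (G : Graph n) where

  Adj : Fin n → Fin n → Set
  Adj u v = adj G u v ≡ true

  data Walk : Fin n → Fin n → ℕ → Set where
    here : ∀ {u} → Walk u u zero
    step : ∀ {u w v k} → Adj u w → Walk w v k → Walk u v (suc k)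

  Connected : Set
  Connected = ∀ u v → ∃ λ k → Walk u v k

  IsDist : Fin n → Fin n → ℕ → Set
  IsDist u v d = Walk u v d × (∀ k → Walk u v k → d ≤ k)

  IsDistanceMatrix : (Fin n → Fin n → ℕ) → Set
  IsDistanceMatrix D = ∀ u v → IsDist u v (D u v)

  InducedP4 : Fin n → Fin n → Fin n → Fin n → Set
  InducedP4 a b c d =
    a ≢ b × a ≢ c × a ≢ d × b ≢ c × b ≢ d × c ≢ d ×
    Adj a b × Adj b c × Adj c d ×
    ¬ Adj a c × ¬ Adj a d × ¬ Adj b d

  InducedC4 : Fin n → Fin n → Fin n → Fin n → Set
  InducedC4 a b c d =
    a ≢ b × a ≢ c × a ≢ d × b ≢ c × b ≢ d × c ≢ d ×
    Adj a b × Adj b c × Adj c d × Adj d a ×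
    ¬ Adj a c × ¬ Adj b d

  TriviallyPerfect : Set
  TriviallyPerfect = ∀ a b c d → ¬ InducedP4 a b c d × ¬ InducedC4 a b c d

  closedN : Fin n → Fin n → Bool
  closedN u w = ⌊ u ≟ w ⌋ ∨ adj G u w

  TrueTwins : Fin n → Fin n → Set
  TrueTwins u v = ∀ w → closedN u w ≡ closedN v w

  -- A partition of V(G) into k blocks W_0..W_{k-1}, given by a block label
  -- for each vertex; every block consists of pairwise true twins.
  blockSize : {k : ℕ} → (Fin n → Fin k) → Fin k → ℕ
  blockSize part i = length (filter (λ v → part v ≟ i) (allFin n))

  TrueTwinPartitionMinSize : ℕ → {k : ℕ} → (Fin n → Fin k) → Set
  TrueTwinPartitionMinSize m {k} part =
    (∀ u v → part u ≡ part v → TrueTwins u v) ×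
    (∀ i → m ≤ blockSize part i)

sumℚ : ∀ {n} → (Fin n → ℚ) → ℚ
sumℚ {zero} f = 0ℚ
sumℚ {suc n} f = f zero + sumℚ (λ i → f (suc i))

ℕtoℚ : ℕ → ℚ
ℕtoℚ d = + d / 1

NullityZero : ∀ {n} → (Fin n → Fin n → ℕ) → Set
NullityZero {n} D =
  ∀ (x : Fin n → ℚ) →
    (∀ i → sumℚ (λ j → ℕtoℚ (D i j) * x j) ≡ 0ℚ) →
    ∀ j → x j ≡ 0ℚ

-- A connected P₄-free graph has diameter at most 2, so D = 2J − 2I − A and D x = 0
-- says x u + Σ_{w ∈ N[u]} x w = t for every vertex u, where t = 2 Σ x.  By induction
-- on vertex sets H that are unions of twin blocks, every solution of this system
-- restricted to H has Σ_H x = F t with F ∈ {0} ∪ [2/3, 1) ∪ [4/3, ∞), and vanishes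
-- when t = 0.  Take v of maximum degree in H.  Closed neighbourhoods of adjacent
-- vertices of a trivially perfect graph are nested, so nothing in C = H ∩ N[v] is
-- adjacent to R = H ∖ N[v].  The vertices U of C adjacent to all of C include the
-- block of v, so s = |U| ≥ 6, and x = t − Σ_C x on U; the rest B = C ∖ U satisfies
-- the system with right-hand side t − s (t − Σ_C x).  Solving for Σ_C x gives a
-- coefficient in [2/3, 1), and adding that of R keeps F in the set above.  Finally
-- Σ x = 2F Σ x with 2F ≠ 1 forces Σ x = 0, hence t = 0 and x = 0.

module Submission where

open import Defs hiding (sym)
open import Data.Nat as ℕ using (ℕ; zero; suc)
import Data.Nat.Properties as ℕ
open import Data.Nat.Coprimality as Coprime using (1-coprimeTo)
open import Data.Nat.Induction using (<-wellFounded)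
import Data.Integer as ℤ
import Data.Integer.Properties as ℤ
open import Data.Fin using (Fin; zero; suc)
open import Data.Fin.Properties using (_≟_)
open import Data.Fin.Subset
  using (Subset; _∈_; _∉_; _⊆_; _⊂_; _∩_; ∁; ⊤; ⁅_⁆; Empty; ∣_∣; inside; outside)
  renaming (⊥ to ∅)
open import Data.Fin.Subset.Properties
  using ( _∈?_; _⊆?_; nonempty?; ∈⊤; drop-there; ∣p∣≤∣x∷p∣
        ; x∈p∩q⁺; x∈p∩q⁻; x∈∁p⇒x∉p; x∉p⇒x∈∁p
        ; p∩q⊆p; ⊆-antisym; ∩-assoc; ∩-comm; ∩-identityˡ; p⊂q⇒∣p∣<∣q∣; Empty-unique
        ; x∈⁅x⁆; x≢y⇒x∉⁅y⁆ )
  renaming (∉⊥ to ∉∅)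
open import Data.Vec using ([]; _∷_; lookup; tabulate; here)
open import Data.Vec.Properties using ([]=⇒lookup; lookup⇒[]=; lookup∘tabulate; tabulate-cong)
open import Data.Bool using (Bool; true; false; if_then_else_; _∧_; not)
import Data.Bool as Bool
open import Data.Bool.Properties using (T-≡)
open import Data.List using (length; filter; allFin)
import Data.List as List
open import Data.List.Extrema ℕ.≤-totalOrder using (argmax; argmax-all; f[xs]≤f[argmax])
open import Data.List.Membership.Propositional.Properties using (∈-filter⁺; ∈-allFin)
import Data.List.Relation.Unary.All as All
open import Data.List.Relation.Unary.All.Properties using (all-filter)
open import Data.Rational
  using ( ℚ; mkℚ; *≤*; 0ℚ; 1ℚ; _+_; _*_; _-_; -_; _/_; _÷_; 1/_; _≤_; _<_
        ; NonZero; positive; negative; nonNegative; nonPositive; >-nonZero; <-nonZero; ≢-nonZero )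
open import Data.Rational.Properties
  using ( normalize-coprime; +-comm; +-identityˡ; +-identityʳ; +-inverseʳ; *-assoc; *-comm
        ; *-identityˡ; *-identityʳ; *-zeroˡ; *-zeroʳ; *-inverseˡ; *-inverseʳ; *-distribˡ-+; *-distribʳ-+
        ; ≤-trans; <⇒≤; ≤⇒≤ᵇ; positive⁻¹; nonNegative⁻¹; +-mono-≤; +-mono-<-≤; +-monoˡ-≤; +-monoʳ-≤
        ; +-monoˡ-<; +-monoʳ-<; *-monoˡ-≤-nonNeg; *-cancelʳ-≤-pos; *-cancelʳ-≤-neg
        ; *-cancelʳ-<-nonNeg; *-cancelʳ-<-nonPos; +-*-commutativeRing )
open import Data.Rational.Solver using (module +-*-Solver)
open +-*-Solver using (solve; _:=_; _:+_; _:*_; _:-_; :-_; con)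
open import Algebra.Bundles using (CommutativeRing)
open import Algebra.Properties.Semiring.Sum (CommutativeRing.semiring +-*-commutativeRing)
  using (sum; sum-cong-≗; sum-replicate-zero; ∑-distrib-+; *-distribˡ-sum)
open import Algebra.Properties.CommutativeSemigroup (CommutativeRing.+-commutativeSemigroup +-*-commutativeRing)
  using (interchange)
open import Data.Empty using (⊥)
open import Data.Product using (Σ; ∃; _×_; _,_; proj₁; proj₂)
open import Data.Sum using (_⊎_; inj₁; inj₂; [_,_]′)
open import Function using (_∘_)
open import Function.Bundles using (Equivalence)
import Induction.WellFounded as WF
import Relation.Binary.Construct.On as On
open import Relation.Binary.PropositionalEquality hiding ([_])
open import Relation.Nullary using (¬_; Dec; yes; no; contradiction)
open import Relation.Nullary.Decidable using (⌊_⌋; toWitness; fromWitness; decidable-stable)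
open import Relation.Unary using (Decidable)

ℕtoℚ≡mkℚ : ∀ m → ℕtoℚ m ≡ mkℚ (ℤ.+ m) 0 (Coprime.sym (1-coprimeTo m))
ℕtoℚ≡mkℚ m = normalize-coprime (Coprime.sym (1-coprimeTo m))

-- Once ℕtoℚ m is in normal form, both sides evaluate to (+ 1 ℤ.+ + m ℤ.* + 1) / 1.
ℕtoℚ-suc : ∀ m → ℕtoℚ (suc m) ≡ 1ℚ + ℕtoℚ m
ℕtoℚ-suc m = trans (cong (λ i → i / 1) (cong (λ i → ℤ.+ 1 ℤ.+ i) (sym (ℤ.*-identityʳ (ℤ.+ m)))))
                   (cong (1ℚ +_) (sym (ℕtoℚ≡mkℚ m)))

ℕtoℚ-mono-≤ : ∀ {m n} → m ℕ.≤ n → ℕtoℚ m ≤ ℕtoℚ n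
ℕtoℚ-mono-≤ {m} {n} m≤n rewrite ℕtoℚ≡mkℚ m | ℕtoℚ≡mkℚ n =
  *≤* (subst₂ ℤ._≤_ (sym (ℤ.*-identityʳ (ℤ.+ m))) (sym (ℤ.*-identityʳ (ℤ.+ n))) (ℤ.+≤+ m≤n))

0≤ℕtoℚ : ∀ m → 0ℚ ≤ ℕtoℚ m
0≤ℕtoℚ m = ℕtoℚ-mono-≤ {0} {m} ℕ.z≤n

≤-by-gap : ∀ {p q} d → p + d ≡ q → 0ℚ ≤ d → p ≤ q
≤-by-gap {p} d refl 0≤d = subst (_≤ p + d) (+-identityʳ p) (+-monoʳ-≤ p 0≤d)

<-by-gap : ∀ {p q} d → p + d ≡ q → 0ℚ < d → p < q
<-by-gap {p} d refl 0<d = subst (_< p + d) (+-identityʳ p) (+-monoʳ-< p 0<d)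

p≤q⇒0≤q-p : ∀ {p q} → p ≤ q → 0ℚ ≤ q - p
p≤q⇒0≤q-p {p} {q} p≤q = subst (_≤ q - p) (+-inverseʳ p) (+-monoˡ-≤ (- p) p≤q)

p<q⇒0<q-p : ∀ {p q} → p < q → 0ℚ < q - p
p<q⇒0<q-p {p} {q} p<q = subst (_< q - p) (+-inverseʳ p) (+-monoˡ-< (- p) p<q)

0≤* : ∀ {p q} → 0ℚ ≤ p → 0ℚ ≤ q → 0ℚ ≤ p * q
0≤* {p} {q} 0≤p 0≤q = subst (_≤ p * q) (*-zeroʳ p) (*-monoˡ-≤-nonNeg p {{nonNegative 0≤p}} 0≤q)

+-move : ∀ a b t → a + b ≡ t → a ≡ t - b
+-move a b t eq = trans (solve 2 (λ a b → a := (a :+ b) :- b) refl a b) (cong (_- b) eq)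

+-rearrange : ∀ a b c t → a + (b + c) ≡ t → a + c ≡ t - b
+-rearrange a b c t eq =
  trans (solve 3 (λ a b c → a :+ c := (a :+ (b :+ c)) :- b) refl a b c) (cong (_- b) eq)

*-cancelʳ-≡ : ∀ {p q} r .{{_ : NonZero r}} → p * r ≡ q * r → p ≡ q
*-cancelʳ-≡ {p} {q} r p*r≡q*r = begin
  p                ≡⟨ sym (*-identityʳ p) ⟩
  p * 1ℚ           ≡⟨ cong (p *_) (sym (*-inverseʳ r)) ⟩
  p * (r * 1/ r)   ≡⟨ sym (*-assoc p r (1/ r)) ⟩
  (p * r) * 1/ r   ≡⟨ cong (_* 1/ r) p*r≡q*r ⟩
  (q * r) * 1/ r   ≡⟨ *-assoc q r (1/ r) ⟩
  q * (r * 1/ r)   ≡⟨ cong (q *_) (*-inverseʳ r) ⟩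
  q * 1ℚ           ≡⟨ *-identityʳ q ⟩
  q                ∎
  where open ≡-Reasoning

÷-*-cancel : ∀ p q .{{_ : NonZero q}} → (p ÷ q) * q ≡ p
÷-*-cancel p q = trans (*-assoc p (1/ q) q) (trans (cong (p *_) (*-inverseˡ q)) (*-identityʳ p))

scaled-÷-*-cancel : ∀ c p q .{{_ : NonZero q}} → (c * (p ÷ q)) * q ≡ c * p
scaled-÷-*-cancel c p q = trans (*-assoc c (p ÷ q) q) (cong (c *_) (÷-*-cancel p q))

quotient-bounds : ∀ {p q} .{{_ : NonZero q}} →
  (0ℚ < q × 0ℚ < p × ℕtoℚ 3 * p ≤ q) ⊎ (q < 0ℚ × p < 0ℚ × q ≤ ℕtoℚ 3 * p) →
  0ℚ < p ÷ q × ℕtoℚ 3 * (p ÷ q) ≤ 1ℚ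
quotient-bounds {p} {q} (inj₁ (0<q , 0<p , 3p≤q)) =
  *-cancelʳ-<-nonNeg q {{nonNegative (<⇒≤ 0<q)}} (subst₂ _<_ (sym (*-zeroˡ q)) (sym (÷-*-cancel p q)) 0<p) ,
  *-cancelʳ-≤-pos q {{positive 0<q}}
    (subst₂ _≤_ (sym (scaled-÷-*-cancel (ℕtoℚ 3) p q)) (sym (*-identityˡ q)) 3p≤q)
quotient-bounds {p} {q} (inj₂ (q<0 , p<0 , q≤3p)) =
  *-cancelʳ-<-nonPos q {{nonPositive (<⇒≤ q<0)}} (subst₂ _<_ (sym (÷-*-cancel p q)) (sym (*-zeroˡ q)) p<0) ,
  *-cancelʳ-≤-neg q {{negative q<0}}
    (subst₂ _≤_ (sym (*-identityˡ q)) (sym (scaled-÷-*-cancel (ℕtoℚ 3) p q)) q≤3p)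

-- Admissible coefficients

Between : ℚ → Set
Between f = ℕtoℚ 2 ≤ ℕtoℚ 3 * f × f < 1ℚ

Admissible : ℚ → Set
Admissible F = F ≡ 0ℚ ⊎ Between F ⊎ ℕtoℚ 4 ≤ ℕtoℚ 3 * F

between+admissible : ∀ {f F} → Between f → Admissible F → Admissible (f + F)
between+admissible {f} f∈ (inj₁ refl) = inj₂ (inj₁ (subst Between (sym (+-identityʳ f)) f∈))
between+admissible {f} {F} (2≤3f , _) (inj₂ (inj₁ (2≤3F , _))) =
  inj₂ (inj₂ (subst (ℕtoℚ 4 ≤_) (sym (*-distribˡ-+ (ℕtoℚ 3) f F)) (+-mono-≤ 2≤3f 2≤3F)))
between+admissible {f} {F} (2≤3f , _) (inj₂ (inj₂ 4≤3F)) =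
  inj₂ (inj₂ (subst (ℕtoℚ 4 ≤_) (sym (*-distribˡ-+ (ℕtoℚ 3) f F))
    (≤-trans 4≤3F (≤-by-gap (ℕtoℚ 3 * f) (+-comm (ℕtoℚ 3 * F) (ℕtoℚ 3 * f))
                            (≤-trans (0≤ℕtoℚ 2) 2≤3f)))))

admissible⇒2*≢1 : ∀ {F} → Admissible F → ℕtoℚ 2 * F ≢ 1ℚ
admissible⇒2*≢1 (inj₁ refl) ()
-- 2F = 1 would give 2 ≤ 3F = 3/2, which is refuted by evaluating _≤ᵇ_.
admissible⇒2*≢1 {F} (inj₂ adm) 2F≡1 = ≤⇒≤ᵇ (subst (ℕtoℚ 2 ≤_) 3F≡3/2 (2≤3F adm))
  where
    3F≡3/2 : ℕtoℚ 3 * F ≡ ℤ.+ 3 / 2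
    3F≡3/2 = trans (solve 1 (λ F → con (ℕtoℚ 3) :* F := con (ℤ.+ 3 / 2) :* (con (ℕtoℚ 2) :* F)) refl F)
                   (trans (cong (ℤ.+ 3 / 2 *_) 2F≡1) (*-identityʳ (ℤ.+ 3 / 2)))
    2≤3F : Between F ⊎ ℕtoℚ 4 ≤ ℕtoℚ 3 * F → ℕtoℚ 2 ≤ ℕtoℚ 3 * F
    2≤3F (inj₁ (2≤3F , _)) = 2≤3F
    2≤3F (inj₂ 4≤3F) = ≤-trans (ℕtoℚ-mono-≤ {2} {4} (ℕ.s≤s (ℕ.s≤s ℕ.z≤n))) 4≤3F

admissible-fixed-point : ∀ {F} → Admissible F → ∀ S → S ≡ F * (ℕtoℚ 2 * S) → S ≡ 0ℚ
admissible-fixed-point {F} adm S S≡ = *-cancelʳ-≡ g (trans S*g≡0 (sym (*-zeroˡ g)))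
  where
    g = 1ℚ - ℕtoℚ 2 * F
    instance
      g≢0 : NonZero g
      g≢0 = ≢-nonZero {g} λ g≡0 → admissible⇒2*≢1 adm
        (trans (solve 1 (λ F → con (ℕtoℚ 2) :* F := con 1ℚ :- (con 1ℚ :- con (ℕtoℚ 2) :* F)) refl F)
               (cong (λ e → 1ℚ - e) g≡0))
    S*g≡0 : S * g ≡ 0ℚ
    S*g≡0 = trans (solve 2 (λ S F → S :* (con 1ℚ :- con (ℕtoℚ 2) :* F) := S :- F :* (con (ℕtoℚ 2) :* S)) refl S F)
                  (trans (cong (λ T → S - T) (sym S≡)) (+-inverseʳ S))

one-minus-between : ∀ {r} → 0ℚ < r → ℕtoℚ 3 * r ≤ 1ℚ → Between (1ℚ - r)
one-minus-between {r} 0<r 3r≤1 =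
  ≤-by-gap (1ℚ - ℕtoℚ 3 * r)
    (solve 1 (λ r → con (ℕtoℚ 2) :+ (con 1ℚ :- con (ℕtoℚ 3) :* r) := con (ℕtoℚ 3) :* (con 1ℚ :- r)) refl r)
    (p≤q⇒0≤q-p 3r≤1) ,
  <-by-gap r (solve 1 (λ r → (con 1ℚ :- r) :+ r := con 1ℚ) refl r) 0<r

admissible⇒gap : ∀ {F} → Admissible F → 0ℚ < 1ℚ - F ⊎ ℕtoℚ 3 * (1ℚ - F) ≤ - 1ℚ
admissible⇒gap (inj₁ refl) = inj₁ (p<q⇒0<q-p (positive⁻¹ 1ℚ))
admissible⇒gap (inj₂ (inj₁ (_ , F<1))) = inj₁ (p<q⇒0<q-p F<1)
admissible⇒gap {F} (inj₂ (inj₂ 4≤3F)) =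
  inj₂ (≤-by-gap (ℕtoℚ 3 * F - ℕtoℚ 4)
    (solve 1 (λ F → con (ℕtoℚ 3) :* (con 1ℚ :- F) :+ (con (ℕtoℚ 3) :* F :- con (ℕtoℚ 4)) := :- con 1ℚ) refl F)
    (p≤q⇒0≤q-p 4≤3F))

denominator-signs : ∀ {s g} → ℕtoℚ 6 ≤ s → 0ℚ < g ⊎ ℕtoℚ 3 * g ≤ - 1ℚ →
  (0ℚ < 1ℚ + s * g × 0ℚ < g × ℕtoℚ 3 * g ≤ 1ℚ + s * g) ⊎
  (1ℚ + s * g < 0ℚ × g < 0ℚ × 1ℚ + s * g ≤ ℕtoℚ 3 * g)
denominator-signs {s} {g} 6≤s (inj₁ 0<g) = inj₁ (0<den , 0<g , 3g≤den)
  where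
    0≤sg : 0ℚ ≤ s * g
    0≤sg = 0≤* (≤-trans (0≤ℕtoℚ 6) 6≤s) (<⇒≤ 0<g)
    0<den : 0ℚ < 1ℚ + s * g
    0<den = +-mono-<-≤ (positive⁻¹ 1ℚ) 0≤sg
    3g≤den : ℕtoℚ 3 * g ≤ 1ℚ + s * g
    3g≤den = ≤-by-gap (1ℚ + (s - ℕtoℚ 3) * g)
      (solve 2 (λ s g → con (ℕtoℚ 3) :* g :+ (con 1ℚ :+ (s :- con (ℕtoℚ 3)) :* g) := con 1ℚ :+ s :* g) refl s g)
      (+-mono-≤ (nonNegative⁻¹ 1ℚ)
        (0≤* (p≤q⇒0≤q-p (≤-trans (ℕtoℚ-mono-≤ {3} {6} (ℕ.s≤s (ℕ.s≤s (ℕ.s≤s ℕ.z≤n)))) 6≤s))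
             (<⇒≤ 0<g)))
denominator-signs {s} {g} 6≤s (inj₂ 3g≤-1) = inj₂ (den<0 , g<0 , den≤3g)
  where
    a b ⅓ : ℚ
    a = - 1ℚ - ℕtoℚ 3 * g
    b = s - ℕtoℚ 6
    ⅓ = ℤ.+ 1 / 3
    0≤a : 0ℚ ≤ a
    0≤a = p≤q⇒0≤q-p 3g≤-1
    0≤b : 0ℚ ≤ b
    0≤b = p≤q⇒0≤q-p 6≤s
    0≤b[1+a]/3 : 0ℚ ≤ ⅓ * b * (1ℚ + a)
    0≤b[1+a]/3 = 0≤* (0≤* (nonNegative⁻¹ ⅓) 0≤b) (+-mono-≤ (nonNegative⁻¹ 1ℚ) 0≤a)
    den<0 : 1ℚ + s * g < 0ℚ
    den<0 = <-by-gap (1ℚ + ℕtoℚ 2 * a + ⅓ * b * (1ℚ + a))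
      (solve 2 (λ s g → let a = :- con 1ℚ :- con (ℕtoℚ 3) :* g ; b = s :- con (ℕtoℚ 6) in
                 con 1ℚ :+ s :* g :+ (con 1ℚ :+ con (ℕtoℚ 2) :* a :+ con ⅓ :* b :* (con 1ℚ :+ a)) := con 0ℚ) refl s g)
      (+-mono-<-≤ (+-mono-<-≤ (positive⁻¹ 1ℚ) (0≤* (0≤ℕtoℚ 2) 0≤a)) 0≤b[1+a]/3)
    g<0 : g < 0ℚ
    g<0 = <-by-gap (⅓ + ⅓ * a)
      (solve 1 (λ g → g :+ (con ⅓ :+ con ⅓ :* (:- con 1ℚ :- con (ℕtoℚ 3) :* g)) := con 0ℚ) refl g)
      (+-mono-<-≤ (positive⁻¹ ⅓) (0≤* (nonNegative⁻¹ ⅓) 0≤a))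
    den≤3g : 1ℚ + s * g ≤ ℕtoℚ 3 * g
    den≤3g = ≤-by-gap (a + ⅓ * b * (1ℚ + a))
      (solve 2 (λ s g → let a = :- con 1ℚ :- con (ℕtoℚ 3) :* g ; b = s :- con (ℕtoℚ 6) in
                 con 1ℚ :+ s :* g :+ (a :+ con ⅓ :* b :* (con 1ℚ :+ a)) := con (ℕtoℚ 3) :* g) refl s g)
      (+-mono-≤ 0≤a 0≤b[1+a]/3)

clique-coefficient : ∀ {s F} → ℕtoℚ 6 ≤ s → Admissible F →
  Σ ℚ λ f → Between f × (∀ T t → T ≡ s * (t - T) + F * (t - s * (t - T)) → T ≡ f * t)
clique-coefficient {s} {F} 6≤s adm = 1ℚ - r , one-minus-between 0<r 3r≤1 , solve-for-T
  where
    g den : ℚ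
    g = 1ℚ - F
    den = 1ℚ + s * g
    signs = denominator-signs 6≤s (admissible⇒gap adm)
    instance
      den≢0 : NonZero den
      den≢0 = [ >-nonZero ∘ proj₁ , <-nonZero ∘ proj₁ ]′ signs
    r : ℚ
    r = g ÷ den
    0<r : 0ℚ < r
    0<r = proj₁ (quotient-bounds signs)
    3r≤1 : ℕtoℚ 3 * r ≤ 1ℚ
    3r≤1 = proj₂ (quotient-bounds signs)
    solve-for-T : ∀ T t → T ≡ s * (t - T) + F * (t - s * (t - T)) → T ≡ (1ℚ - r) * t
    solve-for-T T t T≡E = *-cancelʳ-≡ den (trans T*den≡ (sym [1-r]t*den≡))
      where
        E = s * (t - T) + F * (t - s * (t - T))
        T*den≡ : T * den ≡ (den - g) * t
        T*den≡ = trans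
          (solve 4 (λ T s F t → T :* (con 1ℚ :+ s :* (con 1ℚ :- F))
                       := (con 1ℚ :+ s :* (con 1ℚ :- F) :- (con 1ℚ :- F)) :* t
                          :+ (T :- (s :* (t :- T) :+ F :* (t :- s :* (t :- T))))) refl T s F t)
          (trans (cong (λ e → (den - g) * t + (e - E)) T≡E)
                 (trans (cong ((den - g) * t +_) (+-inverseʳ E)) (+-identityʳ _)))
        [1-r]t*den≡ : ((1ℚ - r) * t) * den ≡ (den - g) * t
        [1-r]t*den≡ = begin
          ((1ℚ - r) * t) * den    ≡⟨ solve 3 (λ r t d → (con 1ℚ :- r) :* t :* d := d :* t :- (r :* d) :* t) refl r t den ⟩
          den * t - (r * den) * t ≡⟨ cong (λ e → den * t - e * t) (÷-*-cancel g den) ⟩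
          den * t - g * t         ≡⟨ solve 3 (λ t d g → d :* t :- g :* t := (d :- g) :* t) refl t den g ⟩
          (den - g) * t           ∎
          where open ≡-Reasoning

∈-tabulate⁺ : ∀ {n} {f : Fin n → Bool} {j} → f j ≡ true → j ∈ tabulate f
∈-tabulate⁺ {f = f} {j} fj = lookup⇒[]= j (tabulate f) (trans (lookup∘tabulate f j) fj)

∈-tabulate⁻ : ∀ {n} {f : Fin n → Bool} {j} → j ∈ tabulate f → f j ≡ true
∈-tabulate⁻ {f = f} {j} j∈ = trans (sym (lookup∘tabulate f j)) ([]=⇒lookup j∈)

∈-∉⇒≢ : ∀ {n} {p : Subset n} {u w} → u ∈ p → w ∉ p → u ≢ w
∈-∉⇒≢ u∈p w∉p refl = w∉p u∈p

subsetOf : ∀ {n} {P : Fin n → Set} → Decidable P → Subset n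
subsetOf P? = tabulate (λ j → ⌊ P? j ⌋)

module _ {n} {P : Fin n → Set} (P? : Decidable P) {j : Fin n} where

  ∈-subsetOf⁺ : P j → j ∈ subsetOf P?
  ∈-subsetOf⁺ Pj = ∈-tabulate⁺ (Equivalence.to T-≡ (fromWitness Pj))

  ∈-subsetOf⁻ : j ∈ subsetOf P? → P j
  ∈-subsetOf⁻ j∈ = toWitness (Equivalence.from T-≡ (∈-tabulate⁻ j∈))

length-filter≤∣∣ : ∀ {a} {A : Set a} {P : A → Set} (P? : Decidable P) {n} (g : Fin n → A) (p : Subset n) →
  (∀ {j} → P (g j) → j ∈ p) → length (filter P? (List.tabulate g)) ℕ.≤ ∣ p ∣
length-filter≤∣∣ P? g [] _ = ℕ.z≤n
length-filter≤∣∣ P? g (s ∷ p) P⇒∈ with P? (g zero)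
... | no  _ = ℕ.≤-trans (length-filter≤∣∣ P? (g ∘ suc) p (drop-there ∘ P⇒∈)) (∣p∣≤∣x∷p∣ s p)
... | yes Pg₀ with P⇒∈ Pg₀
...   | here = ℕ.s≤s (length-filter≤∣∣ P? (g ∘ suc) p (drop-there ∘ P⇒∈))

argmax-in : ∀ {n} (p : Subset n) (f : Fin n → ℕ) →
  Empty p ⊎ Σ (Fin n) λ v → v ∈ p × (∀ {w} → w ∈ p → f w ℕ.≤ f v)
argmax-in {n} p f with nonempty? p
... | no  p-empty       = inj₁ p-empty
... | yes (v₀ , v₀∈p) = inj₂ (v , argmax-all f v₀∈p (all-filter (_∈? p) (allFin n)) , maximal)
  where
    candidates = filter (_∈? p) (allFin n)
    v = argmax f v₀ candidates
    maximal : ∀ {w} → w ∈ p → f w ℕ.≤ f v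
    maximal w∈p = All.lookup (f[xs]≤f[argmax] v₀ candidates) (∈-filter⁺ (_∈? p) (∈-allFin _) w∈p)

sumℚ≡sum : ∀ {n} (f : Fin n → ℚ) → sumℚ f ≡ sum f
sumℚ≡sum {zero} f = refl
sumℚ≡sum {suc n} f = cong (f zero +_) (sumℚ≡sum (f ∘ suc))

restrict : ∀ {n} → Subset n → (Fin n → ℚ) → Fin n → ℚ
restrict p x j = if lookup p j then x j else 0ℚ

sumOver : ∀ {n} → Subset n → (Fin n → ℚ) → ℚ
sumOver p x = sum (restrict p x)

module _ {n} (p : Subset n) (x : Fin n → ℚ) {j : Fin n} where

  restrict-∈ : j ∈ p → restrict p x j ≡ x j
  restrict-∈ j∈p rewrite []=⇒lookup j∈p = refl

  restrict-∉ : j ∉ p → restrict p x j ≡ 0ℚ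
  restrict-∉ j∉p with lookup p j in eq
  ... | true  = contradiction (lookup⇒[]= j p eq) j∉p
  ... | false = refl

sumOver-cong : ∀ {n} (p : Subset n) {x y : Fin n → ℚ} → (∀ {j} → j ∈ p → x j ≡ y j) →
  sumOver p x ≡ sumOver p y
sumOver-cong p {x} {y} x≡y = sum-cong-≗ pointwise
  where
    pointwise : ∀ j → restrict p x j ≡ restrict p y j
    pointwise j with j ∈? p
    ... | yes j∈p = trans (restrict-∈ p x j∈p) (trans (x≡y j∈p) (sym (restrict-∈ p y j∈p)))
    ... | no  j∉p = trans (restrict-∉ p x j∉p) (sym (restrict-∉ p y j∉p))

sumOver-⊤ : ∀ {n} (x : Fin n → ℚ) → sumOver ⊤ x ≡ sum x
sumOver-⊤ x = sum-cong-≗ (λ j → restrict-∈ ⊤ x (∈⊤ {x = j}))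

sumOver-∅ : ∀ {n} (x : Fin n → ℚ) → sumOver ∅ x ≡ 0ℚ
sumOver-∅ {n} x = trans (sum-cong-≗ (λ j → restrict-∉ ∅ x (∉∅ {x = j}))) (sum-replicate-zero n)

sumOver-⁅⁆ : ∀ {n} (u : Fin n) (x : Fin n → ℚ) → sumOver ⁅ u ⁆ x ≡ x u
sumOver-⁅⁆ zero    x = trans (cong (x zero +_) (sumOver-∅ (x ∘ suc))) (+-identityʳ (x zero))
sumOver-⁅⁆ (suc u) x = trans (+-identityˡ _) (sumOver-⁅⁆ u (x ∘ suc))

sumOver-const : ∀ {n} (p : Subset n) c → sumOver p (λ _ → c) ≡ c * ℕtoℚ ∣ p ∣
sumOver-const [] c = sym (*-zeroʳ c)
sumOver-const (inside ∷ p) c = begin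
  c + sumOver p (λ _ → c)     ≡⟨ cong (c +_) (sumOver-const p c) ⟩
  c + c * ℕtoℚ ∣ p ∣          ≡⟨ cong (_+ c * ℕtoℚ ∣ p ∣) (sym (*-identityʳ c)) ⟩
  c * 1ℚ + c * ℕtoℚ ∣ p ∣     ≡⟨ sym (*-distribˡ-+ c 1ℚ _) ⟩
  c * (1ℚ + ℕtoℚ ∣ p ∣)       ≡⟨ cong (c *_) (sym (ℕtoℚ-suc ∣ p ∣)) ⟩
  c * ℕtoℚ (suc ∣ p ∣)        ∎
  where open ≡-Reasoning
sumOver-const (outside ∷ p) c = trans (+-identityˡ _) (sumOver-const p c)

sumOver-split : ∀ {n} (p q : Subset n) x → sumOver p x ≡ sumOver (p ∩ q) x + sumOver (p ∩ ∁ q) x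
sumOver-split [] [] x = refl
sumOver-split (s ∷ p) (t ∷ q) x =
  trans (cong₂ _+_ (head-split s t) (sumOver-split p q (x ∘ suc)))
        (interchange (if s ∧ t then x zero else 0ℚ) (if s ∧ not t then x zero else 0ℚ)
                     (sumOver (p ∩ q) (x ∘ suc)) (sumOver (p ∩ ∁ q) (x ∘ suc)))
  where
    head-split : ∀ s t → (if s then x zero else 0ℚ)
                         ≡ (if s ∧ t then x zero else 0ℚ) + (if s ∧ not t then x zero else 0ℚ)
    head-split false t = refl
    head-split true true = sym (+-identityʳ (x zero))
    head-split true false = sym (+-identityˡ (x zero))

-- Closed neighbourhoods in trivially perfect graphs

module Neighbourhoods {n} (G : Graph n) where

  N[_] : Fin n → Subset n
  N[ u ] = tabulate (closedN G u)

  ∈N⁺ : ∀ {u w} → u ≡ w ⊎ Adj G u w → w ∈ N[ u ]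
  ∈N⁺ {u} {w} u~w = ∈-tabulate⁺ (closed u~w)
    where
      closed : u ≡ w ⊎ Adj G u w → closedN G u w ≡ true
      closed u~w with u ≟ w | u~w
      ... | yes _   | _         = refl
      ... | no  u≢w | inj₁ u≡w = contradiction u≡w u≢w
      ... | no  _   | inj₂ uw  = uw

  ∈N⁻ : ∀ {u w} → w ∈ N[ u ] → u ≡ w ⊎ Adj G u w
  ∈N⁻ {u} {w} w∈N = open-closed (∈-tabulate⁻ w∈N)
    where
      open-closed : closedN G u w ≡ true → u ≡ w ⊎ Adj G u w
      open-closed h with u ≟ w
      ... | yes u≡w = inj₁ u≡w
      ... | no  _   = inj₂ h

  Adj-sym : ∀ {u w} → Adj G u w → Adj G w u
  Adj-sym {u} {w} uw = trans (Graph.sym G w u) uw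

  Adj⇒≢ : ∀ {u w} → Adj G u w → u ≢ w
  Adj⇒≢ {u} uw refl = contradiction (trans (sym uw) (Graph.irrefl G u)) λ ()

  N-refl : ∀ u → u ∈ N[ u ]
  N-refl u = ∈N⁺ (inj₁ refl)

  N-sym : ∀ {u w} → w ∈ N[ u ] → u ∈ N[ w ]
  N-sym w∈N with ∈N⁻ w∈N
  ... | inj₁ refl = w∈N
  ... | inj₂ uw   = ∈N⁺ (inj₂ (Adj-sym uw))

  ∈N⇒Adj : ∀ {u w} → w ∈ N[ u ] → u ≢ w → Adj G u w
  ∈N⇒Adj w∈N u≢w with ∈N⁻ w∈N
  ... | inj₁ u≡w = contradiction u≡w u≢w
  ... | inj₂ uw  = uw

  ∉N⇒¬Adj : ∀ {u w} → w ∉ N[ u ] → ¬ Adj G u w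
  ∉N⇒¬Adj w∉N uw = w∉N (∈N⁺ (inj₂ uw))

  twins⇒N≡ : ∀ {u w} → TrueTwins G u w → N[ u ] ≡ N[ w ]
  twins⇒N≡ twins = tabulate-cong twins

  Adj? : ∀ u w → Dec (Adj G u w)
  Adj? u w = adj G u w Bool.≟ true

  deg : Subset n → Fin n → ℕ
  deg H u = ∣ H ∩ N[ u ] ∣

  WithinTwo : Fin n → Fin n → Set
  WithinTwo u v = u ≡ v ⊎ Adj G u v ⊎ ∃ λ w → Adj G u w × Adj G w v

  dominators : Subset n → Subset n
  dominators C = subsetOf (λ z → C ⊆? N[ z ])

  System : Subset n → (Fin n → ℚ) → ℚ → Set
  System H x t = ∀ {u} → u ∈ H → x u + sumOver (H ∩ N[ u ]) x ≡ t

  module _ (tp : TriviallyPerfect G) where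

    N-nested : ∀ {v c a} → c ∈ N[ v ] → a ∈ N[ c ] → a ∉ N[ v ] → N[ v ] ⊆ N[ c ]
    N-nested {v} {c} {a} c∈Nv a∈Nc a∉Nv {w} w∈Nv = decidable-stable (w ∈? N[ c ]) no-P4-C4
      where
        c≢a = ∈-∉⇒≢ c∈Nv a∉Nv
        v≢a = ∈-∉⇒≢ (N-refl v) a∉Nv
        w≢a = ∈-∉⇒≢ w∈Nv a∉Nv
        c≢v : c ≢ v
        c≢v refl = a∉Nv a∈Nc
        no-P4-C4 : w ∉ N[ c ] → ⊥
        no-P4-C4 w∉Nc = closing (Adj? a w)
          where
            c≢w = ∈-∉⇒≢ (N-refl c) w∉Nc
            v≢w = ∈-∉⇒≢ (N-sym c∈Nv) w∉Nc
            ac  = Adj-sym (∈N⇒Adj a∈Nc c≢a)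
            cv  = ∈N⇒Adj (N-sym c∈Nv) c≢v
            vw  = ∈N⇒Adj w∈Nv v≢w
            ¬av = ∉N⇒¬Adj a∉Nv ∘ Adj-sym
            ¬cw = ∉N⇒¬Adj w∉Nc
            closing : Dec (Adj G a w) → ⊥
            closing (yes aw) = proj₂ (tp a c v w)
              (≢-sym c≢a , ≢-sym v≢a , ≢-sym w≢a , c≢v , c≢w , v≢w , ac , cv , vw , Adj-sym aw , ¬av , ¬cw)
            closing (no ¬aw) = proj₁ (tp a c v w)
              (≢-sym c≢a , ≢-sym v≢a , ≢-sym w≢a , c≢v , c≢w , v≢w , ac , cv , vw , ¬av , ¬aw , ¬cw)

    max-degree-N⊆ : ∀ {H v c} → (∀ {w} → w ∈ H → deg H w ℕ.≤ deg H v) → c ∈ H → c ∈ N[ v ] →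
      H ∩ N[ c ] ⊆ N[ v ]
    max-degree-N⊆ {H} {v} {c} maximal c∈H c∈Nv {w} w∈H∩Nc =
      decidable-stable (w ∈? N[ v ]) λ w∉Nv → ℕ.<⇒≱ (p⊂q⇒∣p∣<∣q∣ (H∩Nv⊂H∩Nc w∉Nv)) (maximal c∈H)
      where
        H∩Nv⊂H∩Nc : w ∉ N[ v ] → H ∩ N[ v ] ⊂ H ∩ N[ c ]
        H∩Nv⊂H∩Nc w∉Nv = H∩Nv⊆H∩Nc , w , w∈H∩Nc , w∉Nv ∘ proj₂ ∘ x∈p∩q⁻ H N[ v ]
          where
            Nv⊆Nc = N-nested c∈Nv (proj₂ (x∈p∩q⁻ H N[ c ] w∈H∩Nc)) w∉Nv
            H∩Nv⊆H∩Nc : H ∩ N[ v ] ⊆ H ∩ N[ c ]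
            H∩Nv⊆H∩Nc u∈H∩Nv with x∈p∩q⁻ H N[ v ] u∈H∩Nv
            ... | u∈H , u∈Nv = x∈p∩q⁺ (u∈H , Nv⊆Nc u∈Nv)

    shortcut : ∀ {u a w v} → Adj G u a → Adj G a w → Adj G w v → WithinTwo u v
    shortcut {u} {a} {w} {v} ua aw wv with u ≟ w | Adj? u w | u ≟ v | Adj? u v | Adj? a v
    ... | yes refl | _      | _       | _      | _      = inj₂ (inj₁ wv)
    ... | no _     | yes uw | _       | _      | _      = inj₂ (inj₂ (w , uw , wv))
    ... | no _     | no _   | yes u≡v | _      | _      = inj₁ u≡v
    ... | no _     | no _   | no _    | yes uv | _      = inj₂ (inj₁ uv)
    ... | no _     | no _   | no _    | no _   | yes av = inj₂ (inj₂ (a , ua , av))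
    ... | no u≢w   | no ¬uw | no u≢v  | no ¬uv | no ¬av =
      contradiction (Adj⇒≢ ua , u≢w , u≢v , Adj⇒≢ aw , a≢v , Adj⇒≢ wv , ua , aw , wv , ¬uw , ¬uv , ¬av)
                    (proj₁ (tp u a w v))
      where
        a≢v : a ≢ v
        a≢v refl = ¬uv ua

    walk⇒within-two : ∀ {u v k} → Walk G u v k → WithinTwo u v
    walk⇒within-two here = inj₁ refl
    walk⇒within-two (step ua walk) with walk⇒within-two walk
    ... | inj₁ refl                 = inj₂ (inj₁ ua)
    ... | inj₂ (inj₁ av)            = inj₂ (inj₂ (_ , ua , av))
    ... | inj₂ (inj₂ (w , aw , wv)) = shortcut ua aw wv

    module Distances (conn : Connected G) {D : Fin n → Fin n → ℕ} (isD : IsDistanceMatrix G D) where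

      dist-self : ∀ u → D u u ≡ 0
      dist-self u = ℕ.n≤0⇒n≡0 (proj₂ (isD u u) 0 here)

      dist-adj : ∀ {u w} → Adj G u w → D u w ≡ 1
      dist-adj {u} {w} uw with D u w | isD u w
      ... | zero        | here , _        = contradiction refl (Adj⇒≢ uw)
      ... | suc zero    | _               = refl
      ... | suc (suc _) | _ , shortest = contradiction (shortest 1 (step uw here)) λ { (ℕ.s≤s ()) }

      dist-far : ∀ {u w} → u ≢ w → ¬ Adj G u w → D u w ≡ 2
      dist-far {u} {w} u≢w ¬uw with walk⇒within-two (proj₂ (conn u w))
      ... | inj₁ u≡w       = contradiction u≡w u≢w
      ... | inj₂ (inj₁ uw) = contradiction uw ¬uw
      ... | inj₂ (inj₂ (z , uz , zw)) with D u w | isD u w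
      ...   | zero              | here , _          = contradiction refl u≢w
      ...   | suc zero          | step uw here , _  = contradiction uw ¬uw
      ...   | suc (suc zero)    | _                 = refl
      ...   | suc (suc (suc _)) | _ , shortest =
        contradiction (shortest 2 (step uz (step zw here))) λ { (ℕ.s≤s (ℕ.s≤s ())) }

      row-term : ∀ x u j → ℕtoℚ (D u j) * x j + restrict N[ u ] x j + restrict ⁅ u ⁆ x j ≡ ℕtoℚ 2 * x j
      row-term x u j with u ≟ j
      ... | yes refl rewrite dist-self u | restrict-∈ N[ u ] x (N-refl u) | restrict-∈ ⁅ u ⁆ x (x∈⁅x⁆ u) =
        solve 1 (λ y → con (ℕtoℚ 0) :* y :+ y :+ y := con (ℕtoℚ 2) :* y) refl (x u)
      ... | no u≢j with Adj? u j
      ...   | yes uj rewrite dist-adj uj | restrict-∈ N[ u ] x (∈N⁺ (inj₂ uj))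
                           | restrict-∉ ⁅ u ⁆ x (x≢y⇒x∉⁅y⁆ (u≢j ∘ sym)) =
        solve 1 (λ y → con (ℕtoℚ 1) :* y :+ y :+ con 0ℚ := con (ℕtoℚ 2) :* y) refl (x j)
      ...   | no ¬uj rewrite dist-far u≢j ¬uj | restrict-∉ N[ u ] x ([ u≢j , ¬uj ]′ ∘ ∈N⁻)
                           | restrict-∉ ⁅ u ⁆ x (x≢y⇒x∉⁅y⁆ (u≢j ∘ sym)) =
        solve 1 (λ y → con (ℕtoℚ 2) :* y :+ con 0ℚ :+ con 0ℚ := con (ℕtoℚ 2) :* y) refl (x j)

      kernel⇒system : ∀ x → (∀ u → sumℚ (λ j → ℕtoℚ (D u j) * x j) ≡ 0ℚ) → System ⊤ x (ℕtoℚ 2 * sum x)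
      kernel⇒system x D·x≡0 {u} _ = sym (begin
        ℕtoℚ 2 * sum x                                              ≡⟨ *-distribˡ-sum (ℕtoℚ 2) x ⟩
        sum (λ j → ℕtoℚ 2 * x j)                                    ≡⟨ sum-cong-≗ (row-term x u) ⟨
        sum (λ j → Dx j + restrict N[ u ] x j + restrict ⁅ u ⁆ x j) ≡⟨ ∑-distrib-+ _ (restrict ⁅ u ⁆ x) ⟩
        sum (λ j → Dx j + restrict N[ u ] x j) + sumOver ⁅ u ⁆ x
          ≡⟨ cong₂ _+_ (∑-distrib-+ Dx (restrict N[ u ] x)) (sumOver-⁅⁆ u x) ⟩
        sum Dx + sumOver N[ u ] x + x u
          ≡⟨ cong (λ r → r + sumOver N[ u ] x + x u) (trans (sym (sumℚ≡sum Dx)) (D·x≡0 u)) ⟩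
        0ℚ + sumOver N[ u ] x + x u
          ≡⟨ solve 2 (λ a b → con 0ℚ :+ a :+ b := b :+ a) refl (sumOver N[ u ] x) (x u) ⟩
        x u + sumOver N[ u ] x
          ≡⟨ cong (λ p → x u + sumOver p x) (∩-identityˡ N[ u ]) ⟨
        x u + sumOver (⊤ ∩ N[ u ]) x                                ∎)
        where
          open ≡-Reasoning
          Dx = λ j → ℕtoℚ (D u j) * x j

-- Blocks of true twins and the linear system

module TwinBlocks {n} (G : Graph n) {k} (part : Fin n → Fin k)
                  (twins : ∀ u w → part u ≡ part w → TrueTwins G u w) where

  open Neighbourhoods G

  BlockClosed : Subset n → Set
  BlockClosed p = ∀ {u w} → part u ≡ part w → u ∈ p → w ∈ p

  ⊤-closed : BlockClosed ⊤
  ⊤-closed _ _ = ∈⊤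

  ∩-closed : ∀ {p q} → BlockClosed p → BlockClosed q → BlockClosed (p ∩ q)
  ∩-closed {p} {q} p-closed q-closed same u∈p∩q with x∈p∩q⁻ p q u∈p∩q
  ... | u∈p , u∈q = x∈p∩q⁺ (p-closed same u∈p , q-closed same u∈q)

  ∁-closed : ∀ {p} → BlockClosed p → BlockClosed (∁ p)
  ∁-closed p-closed same u∈∁p = x∉p⇒x∈∁p (x∈∁p⇒x∉p u∈∁p ∘ p-closed (sym same))

  N-closed : ∀ v → BlockClosed N[ v ]
  N-closed v {u} {w} same u∈Nv = N-sym (subst (v ∈_) (twins⇒N≡ (twins u w same)) (N-sym u∈Nv))

  dominators-closed : ∀ C → BlockClosed (dominators C)
  dominators-closed C {u} {w} same u∈ =
    ∈-subsetOf⁺ (λ z → C ⊆? N[ z ])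
      (subst (C ⊆_) (twins⇒N≡ (twins u w same)) (∈-subsetOf⁻ (λ z → C ⊆? N[ z ]) u∈))

  blockSize≤∣∣ : ∀ {p v} → BlockClosed p → v ∈ p → blockSize G part (part v) ℕ.≤ ∣ p ∣
  blockSize≤∣∣ {p} {v} p-closed v∈p =
    length-filter≤∣∣ (λ w → part w ≟ part v) (λ w → w) p (λ same → p-closed (sym same) v∈p)

module LinearSystem {n} (G : Graph n) (tp : TriviallyPerfect G) {k} (part : Fin n → Fin k)
                    (twins : ∀ u w → part u ≡ part w → TrueTwins G u w)
                    (large : ∀ i → 6 ℕ.≤ blockSize G part i) where

  open Neighbourhoods G
  open TwinBlocks G part twins

  Controlled : Subset n → Set
  Controlled H = Σ ℚ λ F → Admissible F ×
    (∀ x t → System H x t → sumOver H x ≡ F * t × (t ≡ 0ℚ → ∀ {u} → u ∈ H → x u ≡ 0ℚ))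

  controlled-empty : ∀ {H} → Empty H → Controlled H
  controlled-empty {H} H-empty = 0ℚ , inj₁ refl , λ x t _ →
    trans (cong (λ p → sumOver p x) (Empty-unique H-empty)) (trans (sumOver-∅ x) (sym (*-zeroˡ t))) ,
    λ _ u∈H → contradiction (_ , u∈H) H-empty

  module Split {H v} (H-closed : BlockClosed H) (v∈H : v ∈ H)
               (maximal : ∀ {w} → w ∈ H → deg H w ℕ.≤ deg H v) where

    C R Dom U B : Subset n
    C = H ∩ N[ v ]
    R = H ∩ ∁ N[ v ]
    Dom = dominators C
    U = C ∩ Dom
    B = C ∩ ∁ Dom

    s : ℚ
    s = ℕtoℚ ∣ U ∣

    ∈C⁻ : ∀ {u} → u ∈ C → u ∈ H × u ∈ N[ v ]
    ∈C⁻ = x∈p∩q⁻ H N[ v ]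

    C-closed-under-N : ∀ {u w} → u ∈ C → w ∈ H → w ∈ N[ u ] → w ∈ C
    C-closed-under-N u∈C w∈H w∈Nu with ∈C⁻ u∈C
    ... | u∈H , u∈Nv = x∈p∩q⁺ (w∈H , max-degree-N⊆ tp maximal u∈H u∈Nv (x∈p∩q⁺ (w∈H , w∈Nu)))

    H∩N≡C∩N : ∀ {u} → u ∈ C → H ∩ N[ u ] ≡ C ∩ N[ u ]
    H∩N≡C∩N {u} u∈C = ⊆-antisym to from
      where
        to : H ∩ N[ u ] ⊆ C ∩ N[ u ]
        to w∈ with x∈p∩q⁻ H N[ u ] w∈
        ... | w∈H , w∈Nu = x∈p∩q⁺ (C-closed-under-N u∈C w∈H w∈Nu , w∈Nu)
        from : C ∩ N[ u ] ⊆ H ∩ N[ u ]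
        from w∈ with x∈p∩q⁻ C N[ u ] w∈
        ... | w∈C , w∈Nu = x∈p∩q⁺ (proj₁ (∈C⁻ w∈C) , w∈Nu)

    H∩N≡R∩N : ∀ {u} → u ∈ R → H ∩ N[ u ] ≡ R ∩ N[ u ]
    H∩N≡R∩N {u} u∈R = ⊆-antisym to from
      where
        u∈H = proj₁ (x∈p∩q⁻ H (∁ N[ v ]) u∈R)
        u∉Nv = x∈∁p⇒x∉p (proj₂ (x∈p∩q⁻ H (∁ N[ v ]) u∈R))
        to : H ∩ N[ u ] ⊆ R ∩ N[ u ]
        to {w} w∈ with x∈p∩q⁻ H N[ u ] w∈
        ... | w∈H , w∈Nu with w ∈? N[ v ]
        ...   | yes w∈Nv =
          contradiction (proj₂ (∈C⁻ (C-closed-under-N (x∈p∩q⁺ (w∈H , w∈Nv)) u∈H (N-sym w∈Nu)))) u∉Nv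
        ...   | no  w∉Nv = x∈p∩q⁺ (x∈p∩q⁺ (w∈H , x∉p⇒x∈∁p w∉Nv) , w∈Nu)
        from : R ∩ N[ u ] ⊆ H ∩ N[ u ]
        from w∈ with x∈p∩q⁻ R N[ u ] w∈
        ... | w∈R , w∈Nu = x∈p∩q⁺ (proj₁ (x∈p∩q⁻ H (∁ N[ v ]) w∈R) , w∈Nu)

    ∈U⁻ : ∀ {u} → u ∈ U → u ∈ C × C ⊆ N[ u ]
    ∈U⁻ u∈U with x∈p∩q⁻ C Dom u∈U
    ... | u∈C , u∈Dom = u∈C , ∈-subsetOf⁻ (λ z → C ⊆? N[ z ]) u∈Dom

    v∈U : v ∈ U
    v∈U = x∈p∩q⁺ (x∈p∩q⁺ (v∈H , N-refl v) , ∈-subsetOf⁺ (λ z → C ⊆? N[ z ]) (proj₂ ∘ ∈C⁻))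

    C-closed : BlockClosed C
    C-closed = ∩-closed H-closed (N-closed v)

    R-closed : BlockClosed R
    R-closed = ∩-closed H-closed (∁-closed (N-closed v))

    B-closed : BlockClosed B
    B-closed = ∩-closed C-closed (∁-closed (dominators-closed C))

    6≤s : ℕtoℚ 6 ≤ s
    6≤s = ℕtoℚ-mono-≤
      (ℕ.≤-trans (large (part v)) (blockSize≤∣∣ (∩-closed C-closed (dominators-closed C)) v∈U))

    R⊂H : R ⊂ H
    R⊂H = proj₁ ∘ x∈p∩q⁻ H (∁ N[ v ]) , v , v∈H ,
          λ v∈R → x∈∁p⇒x∉p (proj₂ (x∈p∩q⁻ H (∁ N[ v ]) v∈R)) (N-refl v)

    B⊂H : B ⊂ H
    B⊂H = proj₁ ∘ ∈C⁻ ∘ proj₁ ∘ x∈p∩q⁻ C (∁ Dom) , v , v∈H ,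
          λ v∈B → x∈∁p⇒x∉p (proj₂ (x∈p∩q⁻ C (∁ Dom) v∈B)) (proj₂ (x∈p∩q⁻ C Dom v∈U))

    C∩N≡C : ∀ {u} → u ∈ U → C ∩ N[ u ] ≡ C
    C∩N≡C u∈U = ⊆-antisym (p∩q⊆p C N[ _ ]) λ w∈C → x∈p∩q⁺ (w∈C , proj₂ (∈U⁻ u∈U) w∈C)

    C∩N∩Dom≡U : ∀ {u} → u ∈ C → (C ∩ N[ u ]) ∩ Dom ≡ U
    C∩N∩Dom≡U {u} u∈C = ⊆-antisym to from
      where
        to : (C ∩ N[ u ]) ∩ Dom ⊆ U
        to w∈ with x∈p∩q⁻ (C ∩ N[ u ]) Dom w∈
        ... | w∈C∩N , w∈Dom = x∈p∩q⁺ (proj₁ (x∈p∩q⁻ C N[ u ] w∈C∩N) , w∈Dom)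
        from : U ⊆ (C ∩ N[ u ]) ∩ Dom
        from w∈U with x∈p∩q⁻ C Dom w∈U
        ... | w∈C , w∈Dom = x∈p∩q⁺ (x∈p∩q⁺ (w∈C , N-sym (proj₂ (∈U⁻ w∈U) u∈C)) , w∈Dom)

    C∩N∩∁Dom≡B∩N : ∀ u → (C ∩ N[ u ]) ∩ ∁ Dom ≡ B ∩ N[ u ]
    C∩N∩∁Dom≡B∩N u = begin
      (C ∩ N[ u ]) ∩ ∁ Dom ≡⟨ ∩-assoc C N[ u ] (∁ Dom) ⟩
      C ∩ (N[ u ] ∩ ∁ Dom) ≡⟨ cong (C ∩_) (∩-comm N[ u ] (∁ Dom)) ⟩
      C ∩ (∁ Dom ∩ N[ u ]) ≡⟨ ∩-assoc C (∁ Dom) N[ u ] ⟨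
      B ∩ N[ u ]           ∎
      where open ≡-Reasoning

    module _ (x : Fin n → ℚ) (t : ℚ) (sys : System H x t) where

      system-R : System R x t
      system-R {u} u∈R =
        subst (λ p → x u + sumOver p x ≡ t) (H∩N≡R∩N u∈R) (sys (proj₁ (x∈p∩q⁻ H (∁ N[ v ]) u∈R)))

      system-U : ∀ {u} → u ∈ U → x u ≡ t - sumOver C x
      system-U {u} u∈U = +-move (x u) (sumOver C x) t
        (subst (λ p → x u + sumOver p x ≡ t) (trans (H∩N≡C∩N u∈C) (C∩N≡C u∈U)) (sys (proj₁ (∈C⁻ u∈C))))
        where u∈C = proj₁ (∈U⁻ u∈U)

      sum-U : sumOver U x ≡ s * (t - sumOver C x)
      sum-U = trans (sumOver-cong U system-U) (trans (sumOver-const U _) (*-comm _ s))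

      system-B : System B x (t - s * (t - sumOver C x))
      system-B {u} u∈B = subst (λ T → x u + sumOver (B ∩ N[ u ]) x ≡ t - T) sum-U
        (+-rearrange (x u) (sumOver U x) (sumOver (B ∩ N[ u ]) x) t (begin
          x u + (sumOver U x + sumOver (B ∩ N[ u ]) x)
            ≡⟨ cong₂ (λ p q → x u + (sumOver p x + sumOver q x)) (C∩N∩Dom≡U u∈C) (C∩N∩∁Dom≡B∩N u) ⟨
          x u + (sumOver ((C ∩ N[ u ]) ∩ Dom) x + sumOver ((C ∩ N[ u ]) ∩ ∁ Dom) x)
            ≡⟨ cong (x u +_) (sumOver-split (C ∩ N[ u ]) Dom x) ⟨
          x u + sumOver (C ∩ N[ u ]) x
            ≡⟨ cong (λ p → x u + sumOver p x) (H∩N≡C∩N u∈C) ⟨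
          x u + sumOver (H ∩ N[ u ]) x
            ≡⟨ sys (proj₁ (∈C⁻ u∈C)) ⟩
          t ∎))
        where
          open ≡-Reasoning
          u∈C = proj₁ (x∈p∩q⁻ C (∁ Dom) u∈B)

    controlled-step : Controlled B → Controlled R → Controlled H
    controlled-step (F-B , F-B-admissible , solve-B) (F-R , F-R-admissible , solve-R) =
      f + F-R , between+admissible f-between F-R-admissible , solution
      where
        clique = clique-coefficient 6≤s F-B-admissible
        f = proj₁ clique
        f-between = proj₁ (proj₂ clique)
        solution : ∀ x t → System H x t →
          sumOver H x ≡ (f + F-R) * t × (t ≡ 0ℚ → ∀ {u} → u ∈ H → x u ≡ 0ℚ)
        solution x t sys = total , homogeneous
          where
            T-C = sumOver C x
            t-B = t - s * (t - T-C)
            B-solved = solve-B x t-B (system-B x t sys)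
            R-solved = solve-R x t (system-R x t sys)
            T-C≡ : T-C ≡ f * t
            T-C≡ = proj₂ (proj₂ clique) T-C t
              (trans (sumOver-split C Dom x) (cong₂ _+_ (sum-U x t sys) (proj₁ B-solved)))
            total : sumOver H x ≡ (f + F-R) * t
            total = trans (sumOver-split H N[ v ] x)
                          (trans (cong₂ _+_ T-C≡ (proj₁ R-solved)) (sym (*-distribʳ-+ t f F-R)))
            homogeneous : t ≡ 0ℚ → ∀ {u} → u ∈ H → x u ≡ 0ℚ
            homogeneous refl {u} u∈H with u ∈? N[ v ] | u ∈? Dom
            ... | yes u∈Nv | yes u∈Dom =
              trans (system-U x t sys (x∈p∩q⁺ (x∈p∩q⁺ (u∈H , u∈Nv) , u∈Dom)))
                    (cong (λ T → 0ℚ - T) (trans T-C≡ (*-zeroʳ f)))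
            ... | yes u∈Nv | no u∉Dom =
              proj₂ B-solved t-B≡0 (x∈p∩q⁺ (x∈p∩q⁺ (u∈H , u∈Nv) , x∉p⇒x∈∁p u∉Dom))
              where
                t-B≡0 : t-B ≡ 0ℚ
                t-B≡0 = trans (cong (λ T → 0ℚ - s * (0ℚ - T)) (trans T-C≡ (*-zeroʳ f)))
                              (solve 1 (λ s → con 0ℚ :- s :* (con 0ℚ :- con 0ℚ) := con 0ℚ) refl s)
            ... | no u∉Nv | _ = proj₂ R-solved refl (x∈p∩q⁺ (u∈H , x∉p⇒x∈∁p u∉Nv))

  controlled : ∀ H → BlockClosed H → Controlled H
  controlled =
    WF.All.wfRec (On.wellFounded ∣_∣ <-wellFounded) _ (λ H → BlockClosed H → Controlled H) induction-step
    where
      induction-step : ∀ H → (∀ {H′} → ∣ H′ ∣ ℕ.< ∣ H ∣ → BlockClosed H′ → Controlled H′) →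
        BlockClosed H → Controlled H
      induction-step H smaller H-closed with argmax-in H (deg H)
      ... | inj₁ H-empty = controlled-empty H-empty
      ... | inj₂ (v , v∈H , maximal) =
        controlled-step (smaller (p⊂q⇒∣p∣<∣q∣ B⊂H) B-closed) (smaller (p⊂q⇒∣p∣<∣q∣ R⊂H) R-closed)
        where open Split H-closed v∈H maximal

  kernel-trivial : ∀ x → System ⊤ x (ℕtoℚ 2 * sum x) → ∀ j → x j ≡ 0ℚ
  kernel-trivial x system j = proj₂ (solution x t system) t≡0 ∈⊤
    where
      t = ℕtoℚ 2 * sum x
      ⊤-controlled = controlled ⊤ ⊤-closed
      solution = proj₂ (proj₂ ⊤-controlled)
      sum≡0 : sum x ≡ 0ℚ
      sum≡0 = admissible-fixed-point (proj₁ (proj₂ ⊤-controlled)) (sum x)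
                (trans (sym (sumOver-⊤ x)) (proj₁ (solution x t system)))
      t≡0 : t ≡ 0ℚ
      t≡0 = trans (cong (ℕtoℚ 2 *_) sum≡0) (*-zeroʳ (ℕtoℚ 2))

theorem10 : ∀ (n : ℕ) (G : Graph n) → Connected G → TriviallyPerfect G →
    ∀ (k : ℕ) (part : Fin n → Fin k) → TrueTwinPartitionMinSize G 6 part →
    ∀ (D : Fin n → Fin n → ℕ) → IsDistanceMatrix G D →
    NullityZero D
theorem10 n G conn tp k part (twins , large) D isD x D·x≡0 =
  kernel-trivial x (kernel⇒system x D·x≡0)
  where
    open Neighbourhoods G
    open Distances tp conn isD
    open LinearSystem G tp part twins large
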